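{- Let $H$ and $G$ be graphs with $\delta(G)=\delta$, and let $L$ be a list assignment of $H$. If $H$ is not $L$-$G$-free colorable, then there is a subset $S\subseteq V(H)$ such that $|S|>\delta\,|L(S)|$, where $L(S)=\bigcup_{v\in S}L(v)$.
   Context: All graphs are finite, simple and undirected. $H$ is $G$-free if it contains no subgraph isomorphic to $G$. A list assignment $L$ of $H$ assigns to each vertex $v$ a set $L(v)$ of colors. $H$ is $L$-$G$-free colorable if there is a map $c$ with $c(v)\in L(v)$ for every $v\in V(H)$ such that for each color $i$ the induced subgraph $H[\{v:c(v)=i\}]$ is $G$-free. $\delta(G)$ is the minimum degree of $G$. -}

module Defs where

open import Data.Nat using (ℕ; zero; suc; _⊓_)
open import Data.Bool using (Bool; true; false; if_then_else_)
open import Data.Fin using (Fin; zero; suc)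
open import Data.Fin.Subset using (Subset; ⊥; _∪_; _∈_; ∣_∣)
open import Data.Vec using (Vec; []; _∷_; tabulate)
open import Data.Product using (Σ; _×_)
open import Relation.Binary.PropositionalEquality using (_≡_)
open import Relation.Nullary using (¬_)
open import Function.Definitions using (Injective)

record Graph (n : ℕ) : Set where
  field
    adj    : Fin n → Fin n → Bool
    sym    : ∀ u v → adj u v ≡ adj v u
    irrefl : ∀ v → adj v v ≡ false
open Graph public

degree : ∀ {n} → Graph n → Fin n → ℕ
degree H v = ∣ tabulate (adj H v) ∣

minFin : ∀ {m} → (Fin (suc m) → ℕ) → ℕ
minFin {zero}  f = f zero
minFin {suc m} f = f zero ⊓ minFin (λ i → f (suc i))

minDegree : ∀ {m} → Graph (suc m) → ℕ
minDegree G = minFin (degree G)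

-- H[X] contains a subgraph isomorphic to G, where X = {v : P v}:
-- an injective map from V(G) into X sending edges of G to edges of H.
ContainsIn : ∀ {m n} → Graph m → Graph n → (Fin n → Set) → Set
ContainsIn {m} {n} G H P =
  Σ (Fin m → Fin n) λ f →
    Injective _≡_ _≡_ f
    × (∀ u → P (f u))
    × (∀ u v → adj G u v ≡ true → adj H (f u) (f v) ≡ true)

ListAssignment : ℕ → ℕ → Set
ListAssignment n k = Fin n → Subset k

LGFreeColorable : ∀ {m n k} → Graph m → Graph n → ListAssignment n k → Set
LGFreeColorable {m} {n} {k} G H L =
  Σ (Fin n → Fin k) λ c →
    (∀ v → c v ∈ L v)
    × (∀ (i : Fin k) → ¬ ContainsIn G H (λ v → c v ≡ i))

unionL : ∀ {n k} → ListAssignment n k → Subset n → Subset k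
unionL {zero}  L []      = ⊥
unionL {suc n} L (b ∷ S) =
  (if b then L zero else ⊥) ∪ unionL (λ i → L (suc i)) S

-- If no set S is deficient, i.e. |S| ≤ δ |L(S)| for every S, then a
-- capacitated form of Hall's theorem gives a choice c(v) ∈ L(v) in which
-- every colour is used at most δ times.  Since δ = δ(G) ≤ |V(G)| − 1, no
-- colour class is large enough to contain a copy of G.
--
-- Hall's theorem is proved by Rado's list-shrinking argument.  If some list
-- L(v) contains two colours a ≠ b, deleting a or deleting b from L(v) keeps
-- the condition: otherwise there are deficient sets S₁, S₂ for the two
-- shrunken assignments, both containing v, with neighbourhoods X and Y.
-- Every colour of L(S₁ ∪ S₂) lies in X ∪ Y and every colour of
-- L((S₁ ∩ S₂) − v) lies in X ∩ Y, so the condition for these two sets gives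
-- |S₁| + |S₂| ≤ δ(|X| + |Y|) + 1, contradicting deficiency.  Shrinking
-- thus ends with lists of size one (nonempty by Hall's condition on
-- singletons), which form the required choice.
module Submission where

open import Defs
open import Data.Bool using (Bool; true; false; if_then_else_)
open import Data.Bool.Properties using (not-¬)
open import Data.Empty using (⊥; ⊥-elim)
open import Data.Fin using (Fin; zero; suc; _≟_)
open import Data.Fin.Properties using (any?; suc-injective; 0≢1+n)
open import Data.Fin.Subset
  using (Subset; ∣_∣; _∈_; _∉_; _⊆_; _∪_; _∩_; _─_; _-_; ⁅_⁆; ⊤; Nonempty; inside; outside)
open import Data.Fin.Subset.Properties
  using ( ∉⊥; ∈⊤; ∣⊤∣≡n; x∈⁅x⁆; x∈⁅y⁆⇒x≡y; ∣⁅x⁆∣≡1; ⊆-reflexive; p⊆q⇒∣p∣≤∣q∣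
        ; x∈p∪q⁻; x∈p∪q⁺; x∈p∩q⁻; x∈p∩q⁺; p─⊥≡p; p─q⊆p; x∈p∧x≢y⇒x∈p-y; x∈p⇒∣p-x∣<∣p∣
        ; _∈?_; anySubset? )
open import Data.Nat using (ℕ; zero; suc; _+_; _*_; _≤_; _<_; _<?_; z≤n; s≤s; z<s; s≤s⁻¹)
open import Data.Nat.Induction using (<-wellFounded)
open import Data.Nat.Properties
  using ( ≤-refl; ≤-trans; <-trans; ≤-<-trans; 1+n≰n; n<1+n; <⇒≱; ≤⇒≯; ≮⇒≥; n≢0⇒n>0
        ; +-suc; +-mono-≤; +-mono-<-≤; +-mono-≤-<; +-monoʳ-<; *-monoʳ-≤
        ; *-zeroʳ; *-identityʳ; *-distribˡ-+; m⊓n≤m; module ≤-Reasoning )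
open import Data.Product using (Σ; ∃; ∃₂; _×_; _,_; proj₁; proj₂)
open import Data.Sum as Sum using (_⊎_; inj₁; inj₂; [_,_]′)
open import Data.Vec using ([]; _∷_; here; there; tabulate)
open import Data.Vec.Properties using (lookup∘tabulate; []=⇒lookup; lookup⇒[]=)
open import Function using (id; _∘_)
open import Function.Definitions using (Injective)
open import Induction.WellFounded using (Acc; acc)
open import Relation.Binary.PropositionalEquality
  using (_≡_; _≢_; refl; trans; cong; subst; module ≡-Reasoning) renaming (sym to ≡-sym)
open import Relation.Nullary using (¬_; yes; no; does)
open import Relation.Nullary.Decidable using (dec-true)

∣p∪q∣+∣p∩q∣≡∣p∣+∣q∣ : ∀ {n} (p q : Subset n) → ∣ p ∪ q ∣ + ∣ p ∩ q ∣ ≡ ∣ p ∣ + ∣ q ∣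
∣p∪q∣+∣p∩q∣≡∣p∣+∣q∣ []            []            = refl
∣p∪q∣+∣p∩q∣≡∣p∣+∣q∣ (inside ∷ p)  (inside ∷ q)  = cong suc (begin
  ∣ p ∪ q ∣ + suc ∣ p ∩ q ∣   ≡⟨ +-suc ∣ p ∪ q ∣ ∣ p ∩ q ∣ ⟩
  suc (∣ p ∪ q ∣ + ∣ p ∩ q ∣) ≡⟨ cong suc (∣p∪q∣+∣p∩q∣≡∣p∣+∣q∣ p q) ⟩
  suc (∣ p ∣ + ∣ q ∣)         ≡⟨ +-suc ∣ p ∣ ∣ q ∣ ⟨
  ∣ p ∣ + suc ∣ q ∣           ∎)
  where open ≡-Reasoning
∣p∪q∣+∣p∩q∣≡∣p∣+∣q∣ (inside ∷ p)  (outside ∷ q) = cong suc (∣p∪q∣+∣p∩q∣≡∣p∣+∣q∣ p q)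
∣p∪q∣+∣p∩q∣≡∣p∣+∣q∣ (outside ∷ p) (inside ∷ q)  =
  trans (cong suc (∣p∪q∣+∣p∩q∣≡∣p∣+∣q∣ p q)) (≡-sym (+-suc ∣ p ∣ ∣ q ∣))
∣p∪q∣+∣p∩q∣≡∣p∣+∣q∣ (outside ∷ p) (outside ∷ q) = ∣p∪q∣+∣p∩q∣≡∣p∣+∣q∣ p q

x∈p⇒suc∣p-x∣≡∣p∣ : ∀ {n} {x : Fin n} {p : Subset n} → x ∈ p → suc ∣ p - x ∣ ≡ ∣ p ∣
x∈p⇒suc∣p-x∣≡∣p∣ {x = zero}  {inside ∷ p}  here      = cong (suc ∘ ∣_∣) (p─⊥≡p p)
x∈p⇒suc∣p-x∣≡∣p∣ {x = suc x} {inside ∷ p}  (there h) = cong suc (x∈p⇒suc∣p-x∣≡∣p∣ h)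
x∈p⇒suc∣p-x∣≡∣p∣ {x = suc x} {outside ∷ p} (there h) = x∈p⇒suc∣p-x∣≡∣p∣ h

x∈p─q⇒x∉q : ∀ {n} {x : Fin n} {p q : Subset n} → x ∈ p ─ q → x ∉ q
x∈p─q⇒x∉q {p = inside ∷ _}  {inside ∷ _} () here
x∈p─q⇒x∉q {p = outside ∷ _} {inside ∷ _} () here
x∈p─q⇒x∉q {p = _ ∷ _}       {_ ∷ _}      (there h) (there h′) = x∈p─q⇒x∉q h h′

x∈p-y⇒x≢y : ∀ {n} {x y : Fin n} {p : Subset n} → x ∈ p - y → x ≢ y
x∈p-y⇒x≢y {x = x} h refl = x∈p─q⇒x∉q h (x∈⁅x⁆ x)

0<∣p∣⇒Nonempty : ∀ {n} (p : Subset n) → 0 < ∣ p ∣ → Nonempty p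
0<∣p∣⇒Nonempty (inside ∷ p)  _ = zero , here
0<∣p∣⇒Nonempty (outside ∷ p) 0<∣p∣ with 0<∣p∣⇒Nonempty p 0<∣p∣
... | x , x∈p = suc x , there x∈p

1<∣p∣⇒∃-distinct : ∀ {n} {p : Subset n} → 1 < ∣ p ∣ → ∃₂ λ x y → x ∈ p × y ∈ p × x ≢ y
1<∣p∣⇒∃-distinct {p = p} 1<∣p∣ with 0<∣p∣⇒Nonempty p (<-trans z<s 1<∣p∣)
... | x , x∈p with 0<∣p∣⇒Nonempty (p - x) (s≤s⁻¹ (subst (1 <_) (≡-sym (x∈p⇒suc∣p-x∣≡∣p∣ x∈p)) 1<∣p∣))
... | y , y∈p-x = x , y , x∈p , p─q⊆p p ⁅ x ⁆ y∈p-x , x∈p-y⇒x≢y y∈p-x ∘ ≡-sym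

∣p∣≤1∧x∈p∧y∈p⇒x≡y : ∀ {n} {x y : Fin n} {p : Subset n} → ∣ p ∣ ≤ 1 → x ∈ p → y ∈ p → x ≡ y
∣p∣≤1∧x∈p∧y∈p⇒x≡y {x = x} {y} {p} ∣p∣≤1 x∈p y∈p with x ≟ y
... | yes x≡y = x≡y
... | no x≢y = ⊥-elim (1+n≰n (begin
  2                 ≤⟨ s≤s (≤-<-trans z≤n (x∈p⇒∣p-x∣<∣p∣ (x∈p∧x≢y⇒x∈p-y x∈p x≢y))) ⟩
  suc ∣ p - y ∣     ≡⟨ x∈p⇒suc∣p-x∣≡∣p∣ y∈p ⟩
  ∣ p ∣             ≤⟨ ∣p∣≤1 ⟩
  1                 ∎))
  where open ≤-Reasoning

injective⇒≤∣p∣ : ∀ {a n} {p : Subset n} (f : Fin a → Fin n) →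
                 Injective _≡_ _≡_ f → (∀ u → f u ∈ p) → a ≤ ∣ p ∣
injective⇒≤∣p∣ {zero}  f _   _   = z≤n
injective⇒≤∣p∣ {suc a} {p = p} f inj f∈p = begin
  suc a                ≤⟨ s≤s (injective⇒≤∣p∣ (f ∘ suc) (suc-injective ∘ inj) f[suc]∈p-f[0]) ⟩
  suc ∣ p - f zero ∣   ≡⟨ x∈p⇒suc∣p-x∣≡∣p∣ (f∈p zero) ⟩
  ∣ p ∣                ∎
  where
  open ≤-Reasoning
  f[suc]∈p-f[0] : ∀ u → f (suc u) ∈ p - f zero
  f[suc]∈p-f[0] u = x∈p∧x≢y⇒x∈p-y (f∈p (suc u)) (0≢1+n ∘ ≡-sym ∘ inj)

∈tabulate⁺ : ∀ {n} (g : Fin n → Bool) {v} → g v ≡ true → v ∈ tabulate g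
∈tabulate⁺ g {v} gv≡true = lookup⇒[]= v (tabulate g) (trans (lookup∘tabulate g v) gv≡true)

∈tabulate⁻ : ∀ {n} (g : Fin n → Bool) {v} → v ∈ tabulate g → g v ≡ true
∈tabulate⁻ g {v} v∈ = trans (≡-sym (lookup∘tabulate g v)) ([]=⇒lookup v∈)

degree≤m : ∀ {m} (G : Graph (suc m)) v → degree G v ≤ m
degree≤m {m} G v = s≤s⁻¹ (begin
  suc ∣ tabulate (adj G v) ∣ ≤⟨ s≤s (p⊆q⇒∣p∣≤∣q∣ N[v]⊆⊤-v) ⟩
  suc ∣ ⊤ - v ∣             ≡⟨ x∈p⇒suc∣p-x∣≡∣p∣ (∈⊤ {x = v}) ⟩
  ∣ ⊤ {suc m} ∣             ≡⟨ ∣⊤∣≡n (suc m) ⟩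
  suc m                     ∎)
  where
  open ≤-Reasoning
  N[v]⊆⊤-v : tabulate (adj G v) ⊆ ⊤ - v
  N[v]⊆⊤-v w∈N[v] = x∈p∧x≢y⇒x∈p-y ∈⊤ λ { refl → not-¬ (irrefl G v) (∈tabulate⁻ (adj G v) w∈N[v]) }

minFin≤f[0] : ∀ {m} (f : Fin (suc m) → ℕ) → minFin f ≤ f zero
minFin≤f[0] {zero}  f = ≤-refl
minFin≤f[0] {suc m} f = m⊓n≤m (f zero) _

minDegree≤m : ∀ {m} (G : Graph (suc m)) → minDegree G ≤ m
minDegree≤m G = ≤-trans (minFin≤f[0] (degree G)) (degree≤m G zero)

ContainsIn⇒order≤∣p∣ : ∀ {m n} {G : Graph m} {H : Graph n} {P : Fin n → Set} (p : Subset n) →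
                       (∀ {v} → P v → v ∈ p) → ContainsIn G H P → m ≤ ∣ p ∣
ContainsIn⇒order≤∣p∣ p P⊆p (f , f-injective , f∈P , _) = injective⇒≤∣p∣ f f-injective (P⊆p ∘ f∈P)

colourClass : ∀ {n k} → (Fin n → Fin k) → Fin k → Subset n
colourClass c i = tabulate (λ v → does (c v ≟ i))

∈colourClass⁺ : ∀ {n k} (c : Fin n → Fin k) {i v} → c v ≡ i → v ∈ colourClass c i
∈colourClass⁺ c {i} {v} cv≡i = ∈tabulate⁺ _ (dec-true (c v ≟ i) cv≡i)

∈colourClass⁻ : ∀ {n k} (c : Fin n → Fin k) {i v} → v ∈ colourClass c i → c v ≡ i
∈colourClass⁻ c {i} {v} v∈ with c v ≟ i | ∈tabulate⁻ _ v∈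
... | yes cv≡i | _ = cv≡i
... | no _     | ()

∈unionL⁺ : ∀ {n k} (L : ListAssignment n k) {S w i} → w ∈ S → i ∈ L w → i ∈ unionL L S
∈unionL⁺ L {inside ∷ S}  here      i∈L = x∈p∪q⁺ (inj₁ i∈L)
∈unionL⁺ L {_ ∷ S}       (there h) i∈L = x∈p∪q⁺ (inj₂ (∈unionL⁺ (L ∘ suc) h i∈L))

unionL-least : ∀ {n k} (L : ListAssignment n k) {S p} → (∀ {w} → w ∈ S → L w ⊆ p) → unionL L S ⊆ p
unionL-least {zero}  L {[]}    _ i∈ = ⊥-elim (∉⊥ i∈)
unionL-least {suc n} L {b ∷ S} L⊆p i∈ with b | x∈p∪q⁻ (if b then L zero else _) _ i∈
... | inside  | inj₁ i∈L[0] = L⊆p here i∈L[0]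
... | outside | inj₁ i∈∅    = ⊥-elim (∉⊥ i∈∅)
... | _       | inj₂ i∈rest = unionL-least (L ∘ suc) (L⊆p ∘ there) i∈rest

unionL-⁅⁆ : ∀ {n k} (L : ListAssignment n k) v → unionL L ⁅ v ⁆ ⊆ L v
unionL-⁅⁆ L v = unionL-least L (λ w∈⁅v⁆ → ⊆-reflexive (cong L (x∈⁅y⁆⇒x≡y v w∈⁅v⁆)))

removeColour : ∀ {n k} → ListAssignment n k → Fin n → Fin k → ListAssignment n k
removeColour L v a w = if does (w ≟ v) then L w - a else L w

removeColour-⊆ : ∀ {n k} (L : ListAssignment n k) v a w → removeColour L v a w ⊆ L w
removeColour-⊆ L v a w with does (w ≟ v)
... | true  = p─q⊆p (L w) ⁅ a ⁆
... | false = id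

∈removeColour⁺ : ∀ {n k} (L : ListAssignment n k) v a {w j} →
                 j ∈ L w → (w ≡ v → j ≢ a) → j ∈ removeColour L v a w
∈removeColour⁺ L v a {w} j∈L[w] w≡v⇒j≢a with w ≟ v
... | yes w≡v = x∈p∧x≢y⇒x∈p-y j∈L[w] (w≡v⇒j≢a w≡v)
... | no  _   = j∈L[w]

removeColour-size-< : ∀ {n k} (L : ListAssignment n k) {v a} → a ∈ L v →
                      ∣ removeColour L v a v ∣ < ∣ L v ∣
removeColour-size-< L {v} a∈L[v] with v ≟ v
... | yes _   = x∈p⇒∣p-x∣<∣p∣ a∈L[v]
... | no  v≢v = ⊥-elim (v≢v refl)

totalSize : ∀ {n k} → ListAssignment n k → ℕ
totalSize {zero}  L = 0
totalSize {suc n} L = ∣ L zero ∣ + totalSize (L ∘ suc)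

totalSize-mono-≤ : ∀ {n k} {L L′ : ListAssignment n k} →
                   (∀ w → ∣ L′ w ∣ ≤ ∣ L w ∣) → totalSize L′ ≤ totalSize L
totalSize-mono-≤ {zero}  _ = z≤n
totalSize-mono-≤ {suc n} ≤L = +-mono-≤ (≤L zero) (totalSize-mono-≤ (≤L ∘ suc))

totalSize-mono-< : ∀ {n k} {L L′ : ListAssignment n k} {v} →
                   (∀ w → ∣ L′ w ∣ ≤ ∣ L w ∣) → ∣ L′ v ∣ < ∣ L v ∣ → totalSize L′ < totalSize L
totalSize-mono-< {v = zero}  ≤L <L[v] = +-mono-<-≤ <L[v] (totalSize-mono-≤ (≤L ∘ suc))
totalSize-mono-< {v = suc v} ≤L <L[v] = +-mono-≤-< (≤L zero) (totalSize-mono-< (≤L ∘ suc) <L[v])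

removeColour-totalSize-< : ∀ {n k} (L : ListAssignment n k) {v a} → a ∈ L v →
                         totalSize (removeColour L v a) < totalSize L
removeColour-totalSize-< L {v} {a} a∈L[v] =
  totalSize-mono-< (λ w → p⊆q⇒∣p∣≤∣q∣ (removeColour-⊆ L v a w)) (removeColour-size-< L a∈L[v])

module CapacitatedHall (δ : ℕ) where

  HallCondition : ∀ {n k} → ListAssignment n k → Set
  HallCondition {n} L = ∀ (S : Subset n) → ∣ S ∣ ≤ δ * ∣ unionL L S ∣

  Deficient : ∀ {n k} → ListAssignment n k → Subset n → Set
  Deficient L S = δ * ∣ unionL L S ∣ < ∣ S ∣

  CapacitatedChoice : ∀ {n k} → ListAssignment n k → Set
  CapacitatedChoice {n} {k} L =
    Σ (Fin n → Fin k) λ c → (∀ v → c v ∈ L v) × (∀ i → ∣ colourClass c i ∣ ≤ δ)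

  deficient⊎Hall : ∀ {n k} (L : ListAssignment n k) → ∃ (Deficient L) ⊎ HallCondition L
  deficient⊎Hall L with anySubset? (λ S → δ * ∣ unionL L S ∣ <? ∣ S ∣)
  ... | yes deficient = inj₁ deficient
  ... | no ¬deficient = inj₂ λ S → ≮⇒≥ (¬deficient ∘ (S ,_))

  Hall-⊆ : ∀ {n k} {L : ListAssignment n k} → HallCondition L →
           ∀ S {p} → unionL L S ⊆ p → ∣ S ∣ ≤ δ * ∣ p ∣
  Hall-⊆ hall S L[S]⊆p = ≤-trans (hall S) (*-monoʳ-≤ δ (p⊆q⇒∣p∣≤∣q∣ L[S]⊆p))

  Hall⇒0<∣L[v]∣ : ∀ {n k} {L : ListAssignment n k} → HallCondition L → ∀ v → 0 < ∣ L v ∣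
  Hall⇒0<∣L[v]∣ {L = L} hall v = n≢0⇒n>0 λ ∣L[v]∣≡0 → 1+n≰n (begin
    1               ≡⟨ ∣⁅x⁆∣≡1 v ⟨
    ∣ ⁅ v ⁆ ∣       ≤⟨ Hall-⊆ hall ⁅ v ⁆ (unionL-⁅⁆ L v) ⟩
    δ * ∣ L v ∣     ≡⟨ cong (δ *_) ∣L[v]∣≡0 ⟩
    δ * 0           ≡⟨ *-zeroʳ δ ⟩
    0               ∎)
    where open ≤-Reasoning

  Hall⇒singletonChoice : ∀ {n k} {L : ListAssignment n k} →
                         HallCondition L → (∀ v → ∣ L v ∣ ≤ 1) → CapacitatedChoice L
  Hall⇒singletonChoice {n} {k} {L} hall ∣L∣≤1 = c , c∈L , ∣class∣≤δ
    where
    c : Fin n → Fin k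
    c v = proj₁ (0<∣p∣⇒Nonempty (L v) (Hall⇒0<∣L[v]∣ hall v))
    c∈L : ∀ v → c v ∈ L v
    c∈L v = proj₂ (0<∣p∣⇒Nonempty (L v) (Hall⇒0<∣L[v]∣ hall v))
    L[class]⊆⁅i⁆ : ∀ i → unionL L (colourClass c i) ⊆ ⁅ i ⁆
    L[class]⊆⁅i⁆ i = unionL-least L λ {w} w∈class j∈L[w] →
      subst (_∈ ⁅ i ⁆) (trans (≡-sym (∈colourClass⁻ c w∈class)) (∣p∣≤1∧x∈p∧y∈p⇒x≡y (∣L∣≤1 w) (c∈L w) j∈L[w]))
        (x∈⁅x⁆ i)
    ∣class∣≤δ : ∀ i → ∣ colourClass c i ∣ ≤ δ
    ∣class∣≤δ i = begin
      ∣ colourClass c i ∣ ≤⟨ Hall-⊆ hall (colourClass c i) (L[class]⊆⁅i⁆ i) ⟩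
      δ * ∣ ⁅ i ⁆ ∣       ≡⟨ cong (δ *_) (∣⁅x⁆∣≡1 i) ⟩
      δ * 1               ≡⟨ *-identityʳ δ ⟩
      δ                   ∎
      where open ≤-Reasoning

  CapacitatedChoice-⊆ : ∀ {n k} {L L′ : ListAssignment n k} →
                   (∀ w → L′ w ⊆ L w) → CapacitatedChoice L′ → CapacitatedChoice L
  CapacitatedChoice-⊆ L′⊆L (c , c∈L′ , ∣class∣≤δ) = c , (λ v → L′⊆L v (c∈L′ v)) , ∣class∣≤δ

  Hall⇒v∈deficient : ∀ {n k} {L : ListAssignment n k} {v a S} →
                     HallCondition L → Deficient (removeColour L v a) S → v ∈ S
  Hall⇒v∈deficient {L = L} {v} {a} {S} hall deficient with v ∈? S
  ... | yes v∈S = v∈S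
  ... | no  v∉S = ⊥-elim (<⇒≱ deficient (Hall-⊆ hall S L[S]⊆L′[S]))
    where
    L[S]⊆L′[S] : unionL L S ⊆ unionL (removeColour L v a) S
    L[S]⊆L′[S] = unionL-least L λ w∈S j∈L[w] →
      ∈unionL⁺ _ w∈S (∈removeColour⁺ L v a j∈L[w] λ { refl _ → v∉S w∈S })

  Hall⇒¬twoDeficient : ∀ {n k} {L : ListAssignment n k} {v a b S₁ S₂} → HallCondition L → a ≢ b →
                       Deficient (removeColour L v a) S₁ → Deficient (removeColour L v b) S₂ → ⊥
  Hall⇒¬twoDeficient {L = L} {v} {a} {b} {S₁} {S₂} hall a≢b deficient₁ deficient₂ = ≤⇒≯ upper lower
    where
    X Y R : Subset _
    X = unionL (removeColour L v a) S₁
    Y = unionL (removeColour L v b) S₂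
    R = (S₁ ∩ S₂) - v

    v∈S₁ : v ∈ S₁
    v∈S₁ = Hall⇒v∈deficient hall deficient₁
    v∈S₂ : v ∈ S₂
    v∈S₂ = Hall⇒v∈deficient hall deficient₂

    inX : ∀ {w j} → w ∈ S₁ → j ∈ L w → (w ≡ v → j ≢ a) → j ∈ X
    inX w∈S₁ j∈L[w] ok = ∈unionL⁺ _ w∈S₁ (∈removeColour⁺ L v a j∈L[w] ok)
    inY : ∀ {w j} → w ∈ S₂ → j ∈ L w → (w ≡ v → j ≢ b) → j ∈ Y
    inY w∈S₂ j∈L[w] ok = ∈unionL⁺ _ w∈S₂ (∈removeColour⁺ L v b j∈L[w] ok)

    L[S₁∪S₂]⊆X∪Y : unionL L (S₁ ∪ S₂) ⊆ X ∪ Y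
    L[S₁∪S₂]⊆X∪Y = unionL-least L place
      where
      place : ∀ {w} → w ∈ S₁ ∪ S₂ → L w ⊆ X ∪ Y
      place {w} w∈S₁∪S₂ {j} j∈L[w] with w ≟ v
      ... | no w≢v = x∈p∪q⁺ (Sum.map (λ w∈S₁ → inX w∈S₁ j∈L[w] λ w≡v _ → w≢v w≡v)
                                    (λ w∈S₂ → inY w∈S₂ j∈L[w] λ w≡v _ → w≢v w≡v)
                                    (x∈p∪q⁻ S₁ S₂ w∈S₁∪S₂))
      ... | yes refl with j ≟ a
      ...   | yes refl = x∈p∪q⁺ (inj₂ (inY v∈S₂ j∈L[w] λ _ → a≢b))
      ...   | no  j≢a  = x∈p∪q⁺ (inj₁ (inX v∈S₁ j∈L[w] λ _ → j≢a))

    L[R]⊆X∩Y : unionL L R ⊆ X ∩ Y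
    L[R]⊆X∩Y = unionL-least L place
      where
      place : ∀ {w} → w ∈ R → L w ⊆ X ∩ Y
      place w∈R j∈L[w] =
        let w≢v = x∈p-y⇒x≢y w∈R
            (w∈S₁ , w∈S₂) = x∈p∩q⁻ S₁ S₂ (p─q⊆p _ ⁅ v ⁆ w∈R)
        in x∈p∩q⁺ (inX w∈S₁ j∈L[w] (λ w≡v _ → w≢v w≡v) , inY w∈S₂ j∈L[w] (λ w≡v _ → w≢v w≡v))

    upper : ∣ S₁ ∣ + ∣ S₂ ∣ ≤ suc (δ * (∣ X ∣ + ∣ Y ∣))
    upper = begin
      ∣ S₁ ∣ + ∣ S₂ ∣                        ≡⟨ ∣p∪q∣+∣p∩q∣≡∣p∣+∣q∣ S₁ S₂ ⟨
      ∣ S₁ ∪ S₂ ∣ + ∣ S₁ ∩ S₂ ∣              ≡⟨ cong (∣ S₁ ∪ S₂ ∣ +_) (x∈p⇒suc∣p-x∣≡∣p∣ (x∈p∩q⁺ (v∈S₁ , v∈S₂))) ⟨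
      ∣ S₁ ∪ S₂ ∣ + suc ∣ R ∣                ≡⟨ +-suc ∣ S₁ ∪ S₂ ∣ ∣ R ∣ ⟩
      suc (∣ S₁ ∪ S₂ ∣ + ∣ R ∣)              ≤⟨ s≤s (+-mono-≤ (Hall-⊆ hall (S₁ ∪ S₂) L[S₁∪S₂]⊆X∪Y) (Hall-⊆ hall R L[R]⊆X∩Y)) ⟩
      suc (δ * ∣ X ∪ Y ∣ + δ * ∣ X ∩ Y ∣)    ≡⟨ cong suc (*-distribˡ-+ δ ∣ X ∪ Y ∣ ∣ X ∩ Y ∣) ⟨
      suc (δ * (∣ X ∪ Y ∣ + ∣ X ∩ Y ∣))      ≡⟨ cong (λ x → suc (δ * x)) (∣p∪q∣+∣p∩q∣≡∣p∣+∣q∣ X Y) ⟩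
      suc (δ * (∣ X ∣ + ∣ Y ∣))              ∎
      where open ≤-Reasoning

    lower : suc (δ * (∣ X ∣ + ∣ Y ∣)) < ∣ S₁ ∣ + ∣ S₂ ∣
    lower = begin-strict
      suc (δ * (∣ X ∣ + ∣ Y ∣))              ≡⟨ cong suc (*-distribˡ-+ δ ∣ X ∣ ∣ Y ∣) ⟩
      suc (δ * ∣ X ∣ + δ * ∣ Y ∣)            <⟨ s≤s (+-monoʳ-< (δ * ∣ X ∣) (n<1+n (δ * ∣ Y ∣))) ⟩
      suc (δ * ∣ X ∣) + suc (δ * ∣ Y ∣)      ≤⟨ +-mono-≤ deficient₁ deficient₂ ⟩
      ∣ S₁ ∣ + ∣ S₂ ∣                        ∎
      where open ≤-Reasoning

  Hall⇒removeColour-Hall : ∀ {n k} {L : ListAssignment n k} {v a b} → HallCondition L → a ≢ b →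
                           HallCondition (removeColour L v a) ⊎ HallCondition (removeColour L v b)
  Hall⇒removeColour-Hall {L = L} {v} {a} {b} hall a≢b
    with deficient⊎Hall (removeColour L v a) | deficient⊎Hall (removeColour L v b)
  ... | inj₂ hall-a | _          = inj₁ hall-a
  ... | inj₁ _     | inj₂ hall-b = inj₂ hall-b
  ... | inj₁ (_ , deficient₁) | inj₁ (_ , deficient₂) = ⊥-elim (Hall⇒¬twoDeficient hall a≢b deficient₁ deficient₂)

  Hall⇒CapacitatedChoice : ∀ {n k} {L : ListAssignment n k} → HallCondition L → CapacitatedChoice L
  Hall⇒CapacitatedChoice {L = L} = go L (<-wellFounded (totalSize L))
    where
    go : ∀ {n k} (L : ListAssignment n k) → Acc _<_ (totalSize L) → HallCondition L → CapacitatedChoice L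
    go L (acc smaller) hall with any? (λ v → 1 <? ∣ L v ∣)
    ... | no ¬long = Hall⇒singletonChoice hall (λ v → ≮⇒≥ (¬long ∘ (v ,_)))
    ... | yes (v , 1<∣L[v]∣) with 1<∣p∣⇒∃-distinct 1<∣L[v]∣
    ... | a , b , a∈L[v] , b∈L[v] , a≢b with Hall⇒removeColour-Hall {v = v} hall a≢b
    ... | inj₁ hall-a = CapacitatedChoice-⊆ (removeColour-⊆ L v a)
                         (go _ (smaller (removeColour-totalSize-< L a∈L[v])) hall-a)
    ... | inj₂ hall-b = CapacitatedChoice-⊆ (removeColour-⊆ L v b)
                         (go _ (smaller (removeColour-totalSize-< L b∈L[v])) hall-b)

  CapacitatedChoice⇒LGFreeColorable : ∀ {m n k} (H : Graph n) (G : Graph (suc m)) {L : ListAssignment n k} →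
                                      δ ≤ m → CapacitatedChoice L → LGFreeColorable G H L
  CapacitatedChoice⇒LGFreeColorable {m} H G δ≤m (c , c∈L , ∣class∣≤δ) = c , c∈L , classFree
    where
    classFree : ∀ i → ¬ ContainsIn G H (λ v → c v ≡ i)
    classFree i G⊆class = 1+n≰n (begin
      suc m                 ≤⟨ ContainsIn⇒order≤∣p∣ {G = G} {H} (colourClass c i) (∈colourClass⁺ c) G⊆class ⟩
      ∣ colourClass c i ∣   ≤⟨ ∣class∣≤δ i ⟩
      δ                     ≤⟨ δ≤m ⟩
      m                     ∎)
      where open ≤-Reasoning

lemma1 : ∀ {m n k} (H : Graph n) (G : Graph (suc m)) (L : ListAssignment n k)
         → ¬ LGFreeColorable G H L
         → Σ (Subset n) λ S → minDegree G * ∣ unionL L S ∣ < ∣ S ∣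
lemma1 H G L ¬colourable =
  [ id
  , ⊥-elim ∘ ¬colourable ∘ CapacitatedChoice⇒LGFreeColorable H G (minDegree≤m G) ∘ Hall⇒CapacitatedChoice
  ]′ (deficient⊎Hall L)
  where open CapacitatedHall (minDegree G)
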